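{- Let $A, A' : \mathsf{Set}$, $A_R : A \to A' \to \mathsf{Prop}$, $B : A \to \mathsf{Set}$, $B' : A' \to \mathsf{Set}$, and $B_R : \forall (a:A)(a':A'),\ A_R\,a\,a' \to B\,a \to B'\,a' \to \mathsf{Prop}$. Define $R_\Pi : (\forall a:A,\ B\,a) \to (\forall a':A',\ B'\,a') \to \mathsf{Prop}$ by $R_\Pi\,f\,f' := \forall (a:A)(a':A')(a_R : A_R\,a\,a'),\ B_R\,a\,a'\,a_R\,(f\,a)\,(f'\,a')$. If $\mathrm{Total}(A_R)$ and for all $a, a', a_R : A_R\,a\,a'$ $\mathrm{OneToOne}(B_R\,a\,a'\,a_R)$, then $\mathrm{OneToOne}(R_\Pi)$.
   Context: Coq's type theory (CIC) with universes $\mathsf{Prop}$, $\mathsf{Set}$, assuming the dependent function extensionality axiom ($\forall (X:\mathsf{Type})(Y : X \to \mathsf{Type})(f\,g : \forall x, Y\,x),\ (\forall x,\ f\,x = g\,x) \to f = g$). $\{x:T \,\&\, P\,x\}$ is a Σ type, $\times$ a product. For $X,Y:\mathsf{Set}$ and $R : X\to Y\to\mathsf{Prop}$: $\mathrm{Total}(R) := (\forall x,\{y \,\&\, R\,x\,y\}) \times (\forall y,\{x \,\&\, R\,x\,y\})$; $\mathrm{OneToOne}(R) := (\forall x\,y_1\,y_2,\ R\,x\,y_1 \to R\,x\,y_2 \to y_1 = y_2) \wedge (\forall y\,x_1\,x_2,\ R\,x_1\,y \to R\,x_2\,y \to x_1 = x_2)$. -}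

module Defs where

open import Data.Product using (Σ; _×_)
open import Relation.Binary.PropositionalEquality using (_≡_)

-- Coq's Prop and Set are both rendered as Agda's Set (= Set₀).

-- Dependent function extensionality (an assumption in the paper's setting),
-- at the level of Coq's Type, rendered here as Set₀.
DepFunExt : Set₁
DepFunExt = (X : Set) (Y : X → Set) (f g : (x : X) → Y x) →
            ((x : X) → f x ≡ g x) → f ≡ g

Total : {X Y : Set} → (X → Y → Set) → Set
Total {X} {Y} R = ((x : X) → Σ Y (λ y → R x y)) × ((y : Y) → Σ X (λ x → R x y))

OneToOne : {X Y : Set} → (X → Y → Set) → Set
OneToOne {X} {Y} R =
  ((x : X) (y₁ y₂ : Y) → R x y₁ → R x y₂ → y₁ ≡ y₂) ×
  ((y : Y) (x₁ x₂ : X) → R x₁ y → R x₂ y → x₁ ≡ x₂)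

RΠ : {A A' : Set} (AR : A → A' → Set) {B : A → Set} {B' : A' → Set}
     (BR : (a : A) (a' : A') → AR a a' → B a → B' a' → Set) →
     ((a : A) → B a) → ((a' : A') → B' a') → Set
RΠ {A} {A'} AR BR f f' = (a : A) (a' : A') (aR : AR a a') → BR a a' aR (f a) (f' a')

module Submission where

open import Defs
open import Data.Product using (Σ; _×_; _,_; proj₁; proj₂)
open import Relation.Binary.PropositionalEquality using (_≡_)

-- Two related functions agree at each point of the other side because that point has some
-- related partner; one-to-one-ness of B_R at that pair then forces the values to coincide.

module _ (funext : DepFunExt) {A A' : Set} (AR : A → A' → Set)
         {B : A → Set} {B' : A' → Set}
         (BR : (a : A) (a' : A') → AR a a' → B a → B' a' → Set) where

  RΠ-functional :
    ((a' : A') → Σ A (λ a → AR a a')) →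
    ((a : A) (a' : A') (aR : AR a a') (b : B a) (b₁' b₂' : B' a') →
       BR a a' aR b b₁' → BR a a' aR b b₂' → b₁' ≡ b₂') →
    (f : (a : A) → B a) (f₁' f₂' : (a' : A') → B' a') →
    RΠ AR BR f f₁' → RΠ AR BR f f₂' → f₁' ≡ f₂'
  RΠ-functional surj functional f f₁' f₂' r₁ r₂ = funext A' B' f₁' f₂' pointwise
    where
    pointwise : (a' : A') → f₁' a' ≡ f₂' a'
    pointwise a' with surj a'
    ... | a , aR = functional a a' aR (f a) (f₁' a') (f₂' a') (r₁ a a' aR) (r₂ a a' aR)

  RΠ-injective :
    ((a : A) → Σ A' (λ a' → AR a a')) →
    ((a : A) (a' : A') (aR : AR a a') (b' : B' a') (b₁ b₂ : B a) →
       BR a a' aR b₁ b' → BR a a' aR b₂ b' → b₁ ≡ b₂) →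
    (f' : (a' : A') → B' a') (f₁ f₂ : (a : A) → B a) →
    RΠ AR BR f₁ f' → RΠ AR BR f₂ f' → f₁ ≡ f₂
  RΠ-injective total injective f' f₁ f₂ r₁ r₂ = funext A B f₁ f₂ pointwise
    where
    pointwise : (a : A) → f₁ a ≡ f₂ a
    pointwise a with total a
    ... | a' , aR = injective a a' aR (f' a') (f₁ a) (f₂ a) (r₁ a a' aR) (r₂ a a' aR)

lemma9 : DepFunExt →
    (A A' : Set) (AR : A → A' → Set) (B : A → Set) (B' : A' → Set)
    (BR : (a : A) (a' : A') → AR a a' → B a → B' a' → Set) →
    Total AR →
    ((a : A) (a' : A') (aR : AR a a') → OneToOne (BR a a' aR)) →
    OneToOne (RΠ AR {B} {B'} BR)
lemma9 funext A A' AR B B' BR (total , surj) oneToOne =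
  RΠ-functional funext AR BR surj (λ a a' aR → proj₁ (oneToOne a a' aR)) ,
  RΠ-injective funext AR BR total (λ a a' aR → proj₂ (oneToOne a a' aR))
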